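{- Let $n\ge 1$ and let $\pi=\pi_1\pi_2\ldots\pi_n\in\mathcal{DU}_n(4123)$. Write $\mathcal{A}(\pi)=\{a_0,a_1,\ldots,a_p\}$ with $p\ge 0$ and $0=a_0<a_1<\cdots<a_p$, and set $a_{p+1}=\pi_1$. Let $a,b$ be integers such that $a_{j+1}+2\ge a>b\ge a_j+1$ for some $j$ with $0\le j\le p$, and $b\le\pi_1$. Then $\pi'=(a,b)\rightarrow\pi$ is a permutation in $\mathcal{DU}_{n+2}(4123)$ satisfying: (i) if $b=a_j+1$ and $j\ge 1$, then $\mathcal{A}(\pi')=\{a_0,a_1,\ldots,a_{j-1},b\}$ when $a>b+1$, and $\mathcal{A}(\pi')=\{a_0,a_1,\ldots,a_{j-1}\}$ when $a=b+1$; (ii) otherwise, $\mathcal{A}(\pi')=\{a_0,a_1,\ldots,a_j,b\}$ when $a>b+1$, and $\mathcal{A}(\pi')=\{a_0,a_1,\ldots,a_j\}$ when $a=b+1$.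
   Context: For $[m]=\{1,\ldots,m\}$, a permutation $\pi=\pi_1\cdots\pi_m$ of $[m]$ is down-up alternating if $\pi_1>\pi_2<\pi_3>\pi_4<\cdots$. A permutation $\pi$ contains the pattern $\tau=\tau_1\cdots\tau_k$ if some subsequence $\pi_{i_1}\cdots\pi_{i_k}$ ($i_1<\cdots<i_k$) is order-isomorphic to $\tau$; otherwise it avoids $\tau$. $\mathcal{DU}_m(4123)$ denotes the set of $4123$-avoiding down-up alternating permutations of $[m]$. For a permutation $\pi$, $\mathcal{A}(\pi)=\{0\}\cup\{k : \exists\, i<j \text{ with } \pi_i=k,\ \pi_j=k+1,\ \text{and } k\le \pi_1-2\}$. For $a,b\in[n+2]$ with $b<a$, $(a,b)\rightarrow\pi$ denotes the permutation $u=u_1\cdots u_{n+2}$ of $[n+2]$ with $u_1=a$, $u_2=b$, and $u_3\cdots u_{n+2}$ order-isomorphic to $\pi$; explicitly, for $i\ge 3$, $u_i=\pi_{i-2}$ if $\pi_{i-2}<b$, $u_i=\pi_{i-2}+1$ if $b\le\pi_{i-2}<a-1$, and $u_i=\pi_{i-2}+2$ if $\pi_{i-2}\ge a-1$. -}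

module Defs where

open import Data.Nat using (ℕ; zero; suc; _+_; _∸_; _≤_; _<_; _<ᵇ_)
open import Data.Bool using (if_then_else_)
open import Data.List using (List; []; _∷_; map; length; lookup; upTo)
open import Data.List.Relation.Binary.Permutation.Propositional using (_↭_)
open import Data.Fin using (Fin) renaming (_<_ to _<ᶠ_)
open import Data.Product using (Σ; _×_; ∃-syntax)
open import Data.Sum using (_⊎_)
open import Data.Unit using (⊤)
open import Relation.Nullary using (¬_)
open import Relation.Binary.PropositionalEquality using (_≡_)

IsPerm : ℕ → List ℕ → Set
IsPerm m π = π ↭ map suc (upTo m)

mutual
  DownUp : List ℕ → Set
  DownUp []                = ⊤
  DownUp (x ∷ [])          = ⊤
  DownUp (x ∷ y ∷ rest)    = y < x × UpDown (y ∷ rest)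

  UpDown : List ℕ → Set
  UpDown []                = ⊤
  UpDown (x ∷ [])          = ⊤
  UpDown (x ∷ y ∷ rest)    = x < y × DownUp (y ∷ rest)

Contains4123 : List ℕ → Set
Contains4123 π =
  ∃[ i₁ ] ∃[ i₂ ] ∃[ i₃ ] ∃[ i₄ ]
    ((i₁ <ᶠ i₂) × (i₂ <ᶠ i₃) × (i₃ <ᶠ i₄) ×
     (lookup π i₂ < lookup π i₃) × (lookup π i₃ < lookup π i₄) × (lookup π i₄ < lookup π i₁))

InDU4123 : ℕ → List ℕ → Set
InDU4123 m π = IsPerm m π × DownUp π × ¬ Contains4123 π

-- first entry π₁ (only used for non-empty π)
first : List ℕ → ℕ
first []      = 0
first (x ∷ _) = x

-- k ∈ 𝒜(π):  k = 0, or there are i<j with πᵢ = k, πⱼ = k+1 and k ≤ π₁ − 2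
-- (the latter written k + 2 ≤ π₁, which is the correct reading also when π₁ < 2).
InA : List ℕ → ℕ → Set
InA π k = k ≡ 0 ⊎
  (∃[ i ] ∃[ j ] ((i <ᶠ j) × (lookup π i ≡ k) × (lookup π j ≡ suc k) × (k + 2 ≤ first π)))

shift : ℕ → ℕ → ℕ → ℕ
shift a b x = if x <ᵇ b then x else (if x <ᵇ (a ∸ 1) then suc x else suc (suc x))

insertAB : ℕ → ℕ → List ℕ → List ℕ
insertAB a b π = a ∷ b ∷ map (shift a b) π

module Submission where

-- Occurrences of patterns and of the pairs (k, k+1) defining 𝒜 are handled
-- as subsequences (sublists, ⊆) instead of index tuples.

open import Defs
open import Data.Nat using (ℕ; zero; suc; _+_; _≤_; _<_; _<ᵇ_; z≤n; s≤s)
open import Data.Nat.Properties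
open import Data.Bool using (true; false; if_then_else_)
open import Data.List using (List; []; _∷_; map; length; lookup; upTo; drop)
open import Data.List.Membership.Propositional {A = ℕ} using (_∈_)
open import Data.List.Membership.Propositional.Properties
  using (∈-map⁺; ∈-map⁻; ∈-upTo⁺; ∈-upTo⁻)
open import Data.List.Relation.Unary.Any using (here; there)
import Data.List.Relation.Unary.All as All
open import Data.List.Relation.Unary.AllPairs using (_∷_)
open import Data.List.Relation.Unary.Unique.Propositional {A = ℕ} using (Unique)
import Data.List.Relation.Unary.Unique.Propositional.Properties as Unique
open import Data.List.Relation.Binary.Sublist.Propositional {A = ℕ}
  using (_⊆_; []; _∷_; _∷ʳ_; minimum; to∈; from∈)
open import Data.List.Relation.Binary.Sublist.Propositional.Properties
  using (∷ˡ⁻; map⁺)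
open import Data.List.Relation.Binary.Pointwise using (Pointwise; []; _∷_)
open import Data.List.Relation.Binary.Permutation.Propositional
  using (↭⇒↭ₛ; ↭-sym)
open import Data.List.Relation.Binary.Permutation.Propositional.Properties
  using (∈-resp-↭)
open import Data.List.Relation.Binary.Permutation.Setoid.Properties
  using (Unique-resp-↭)
open import Data.List.Relation.Binary.BagAndSetEquality using (∼bag⇒↭)
open import Data.List.Membership.Propositional.Properties.WithK
  using (unique∧set⇒bag)
open import Data.Fin using (Fin; toℕ) renaming (zero to fzero; suc to fsuc)
open import Data.Product using (Σ; _×_; _,_; ∃-syntax; proj₁; proj₂)
open import Data.Sum using (_⊎_; inj₁; inj₂; map₂)
open import Data.Sum.Function.Propositional using (_⊎-⇔_)
open import Data.Unit using (tt)
open import Data.Empty using (⊥; ⊥-elim)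
open import Function using (_∘_)
open import Function.Bundles using (_⇔_; mk⇔; Equivalence)
open import Function.Construct.Composition using (_⇔-∘_)
open import Function.Construct.Identity using (⇔-id)
open import Relation.Binary.Core using (_Preserves_⟶_)
open import Relation.Binary.Definitions using (tri<; tri≈; tri>)
open import Relation.Nullary using (¬_; yes; no)
open import Relation.Binary.PropositionalEquality

lookup∷⊆drop : ∀ {ys} xs m (i : Fin (length xs)) → m ≤ toℕ i →
               ys ⊆ drop (suc (toℕ i)) xs → lookup xs i ∷ ys ⊆ drop m xs
lookup∷⊆drop (x ∷ xs) zero    fzero    _         h = refl ∷ h
lookup∷⊆drop (x ∷ xs) zero    (fsuc i) _         h = x ∷ʳ lookup∷⊆drop xs zero i z≤n h
lookup∷⊆drop (x ∷ xs) (suc m) (fsuc i) (s≤s m≤i) h = lookup∷⊆drop xs m i m≤i h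

∷⊆drop⇒lookup : ∀ {v vs} xs m → v ∷ vs ⊆ drop m xs →
  Σ (Fin (length xs)) λ i → m ≤ toℕ i × lookup xs i ≡ v × vs ⊆ drop (suc (toℕ i)) xs
∷⊆drop⇒lookup []       zero    ()
∷⊆drop⇒lookup []       (suc m) ()
∷⊆drop⇒lookup (x ∷ xs) zero    (refl ∷ h) = fzero , z≤n , refl , h
∷⊆drop⇒lookup (x ∷ xs) zero    (_ ∷ʳ h) with ∷⊆drop⇒lookup xs zero h
... | i , _ , xsᵢ≡v , h′ = fsuc i , z≤n , xsᵢ≡v , h′
∷⊆drop⇒lookup (x ∷ xs) (suc m) h with ∷⊆drop⇒lookup xs m h
... | i , m≤i , xsᵢ≡v , h′ = fsuc i , s≤s m≤i , xsᵢ≡v , h′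

Occurs4123 : List ℕ → Set
Occurs4123 xs = Σ ℕ λ w → Σ ℕ λ x → Σ ℕ λ y → Σ ℕ λ z →
  x < y × y < z × z < w × (w ∷ x ∷ y ∷ z ∷ []) ⊆ xs

contains⇒occurs : ∀ xs → Contains4123 xs → Occurs4123 xs
contains⇒occurs xs (i₁ , i₂ , i₃ , i₄ , i₁<i₂ , i₂<i₃ , i₃<i₄ , x<y , y<z , z<w) =
  _ , _ , _ , _ , x<y , y<z , z<w ,
  lookup∷⊆drop xs 0 i₁ z≤n (lookup∷⊆drop xs _ i₂ i₁<i₂
    (lookup∷⊆drop xs _ i₃ i₂<i₃ (lookup∷⊆drop xs _ i₄ i₃<i₄ (minimum _))))

occurs⇒contains : ∀ xs {w x y z} → x < y → y < z → z < w →
                  (w ∷ x ∷ y ∷ z ∷ []) ⊆ xs → Contains4123 xs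
occurs⇒contains xs x<y y<z z<w h with ∷⊆drop⇒lookup xs 0 h
... | i₁ , _ , e₁ , h₁ with ∷⊆drop⇒lookup xs _ h₁
... | i₂ , i₁<i₂ , e₂ , h₂ with ∷⊆drop⇒lookup xs _ h₂
... | i₃ , i₂<i₃ , e₃ , h₃ with ∷⊆drop⇒lookup xs _ h₃
... | i₄ , i₃<i₄ , e₄ , _ =
  i₁ , i₂ , i₃ , i₄ , i₁<i₂ , i₂<i₃ , i₃<i₄ ,
  subst₂ _<_ (sym e₂) (sym e₃) x<y ,
  subst₂ _<_ (sym e₃) (sym e₄) y<z ,
  subst₂ _<_ (sym e₄) (sym e₁) z<w

inA⇒ascent : ∀ xs k → InA xs k → k ≡ 0 ⊎ (k ∷ suc k ∷ [] ⊆ xs × k + 2 ≤ first xs)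
inA⇒ascent xs k (inj₁ k≡0) = inj₁ k≡0
inA⇒ascent xs k (inj₂ (i , j , i<j , xsᵢ≡k , xsⱼ≡k+1 , bound)) =
  inj₂ (subst₂ (λ u v → u ∷ v ∷ [] ⊆ xs) xsᵢ≡k xsⱼ≡k+1
          (lookup∷⊆drop xs 0 i z≤n (lookup∷⊆drop xs _ j i<j (minimum _))) , bound)

ascent⇒inA : ∀ xs k → k ∷ suc k ∷ [] ⊆ xs → k + 2 ≤ first xs → InA xs k
ascent⇒inA xs k h bound with ∷⊆drop⇒lookup xs 0 h
... | i , _ , xsᵢ≡k , h₁ with ∷⊆drop⇒lookup xs _ h₁
... | j , i<j , xsⱼ≡k+1 , _ = inj₂ (i , j , i<j , xsᵢ≡k , xsⱼ≡k+1 , bound)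

-- The relative order of the entries of a duplicate-free list.  Here the pair
-- x ∷ y ∷ [] ⊆ xs reads "x occurs before y in xs".

head∉tail : ∀ {x xs} → Unique (x ∷ xs) → ¬ x ∈ xs
head∉tail (x∉ ∷ _) x∈ = All.lookup x∉ x∈ refl

second∈tail : ∀ {x y z zs} → x ∷ y ∷ [] ⊆ z ∷ zs → y ∈ zs
second∈tail (refl ∷ h) = to∈ h
second∈tail (_ ∷ʳ h)   = to∈ (∷ˡ⁻ h)

before-asym : ∀ {x y xs} → Unique xs → x ∷ y ∷ [] ⊆ xs → ¬ y ∷ x ∷ [] ⊆ xs
before-asym u        (refl ∷ h₁) (refl ∷ h₂) = head∉tail u (to∈ h₁)
before-asym u        (refl ∷ h₁) h₂@(_ ∷ʳ _) = head∉tail u (second∈tail h₂)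
before-asym u        h₁@(_ ∷ʳ _) (refl ∷ h₂) = head∉tail u (second∈tail h₁)
before-asym (_ ∷ u)  (_ ∷ʳ h₁)   (_ ∷ʳ h₂)   = before-asym u h₁ h₂

before-total : ∀ {x y xs} → x ∈ xs → y ∈ xs → x ≢ y →
               x ∷ y ∷ [] ⊆ xs ⊎ y ∷ x ∷ [] ⊆ xs
before-total (here refl) (here refl) x≢y = ⊥-elim (x≢y refl)
before-total (here refl) (there y∈)  _   = inj₁ (refl ∷ from∈ y∈)
before-total (there x∈)  (here refl) _   = inj₂ (refl ∷ from∈ x∈)
before-total {xs = z ∷ _} (there x∈) (there y∈) x≢y with before-total x∈ y∈ x≢y
... | inj₁ h = inj₁ (z ∷ʳ h)
... | inj₂ h = inj₂ (z ∷ʳ h)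

before-trans : ∀ {x y z xs} → Unique xs →
               x ∷ y ∷ [] ⊆ xs → y ∷ z ∷ [] ⊆ xs → x ∷ z ∷ [] ⊆ xs
before-trans u       (refl ∷ h₁) (refl ∷ _)  = ⊥-elim (head∉tail u (to∈ h₁))
before-trans _       (refl ∷ _)  h₂@(_ ∷ʳ _) = refl ∷ from∈ (second∈tail h₂)
before-trans u       h₁@(_ ∷ʳ _) (refl ∷ _)  = ⊥-elim (head∉tail u (second∈tail h₁))
before-trans (_ ∷ u) (w ∷ʳ h₁)   (_ ∷ʳ h₂)   = w ∷ʳ before-trans u h₁ h₂

-- In a 4123-avoiding list without repetitions, no increasing triple c < d < e
-- with e ≤ x can follow the first entry x: it would complete x c d e to a 4123.
no-increasing-triple : ∀ {x xs c d e} → Unique (x ∷ xs) → ¬ Contains4123 (x ∷ xs) →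
  c ∷ d ∷ e ∷ [] ⊆ x ∷ xs → c < d → d < e → e ≤ x → ⊥
no-increasing-triple _ _ (refl ∷ _) c<d d<e e≤c = <⇒≱ (<-trans c<d d<e) e≤c
no-increasing-triple {x} u av (_ ∷ʳ h) c<d d<e e≤x =
  av (occurs⇒contains (x ∷ _) c<d d<e e<x (refl ∷ h))
  where
    e≢x : _ ≢ x
    e≢x e≡x = head∉tail u (subst (_∈ _) e≡x (to∈ (∷ˡ⁻ (∷ˡ⁻ h))))
    e<x : _ < x
    e<x = ≤∧≢⇒< e≤x e≢x

module StrictlyIncreasing (f : ℕ → ℕ) (f-mono : f Preserves _<_ ⟶ _<_) where

  reflects-< : ∀ {x y} → f x < f y → x < y
  reflects-< {x} {y} fx<fy with <-cmp x y
  ... | tri< x<y _ _ = x<y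
  ... | tri≈ _ refl _ = ⊥-elim (<-irrefl refl fx<fy)
  ... | tri> _ _ y<x = ⊥-elim (<-asym fx<fy (f-mono y<x))

  injective : ∀ {x y} → f x ≡ f y → x ≡ y
  injective {x} {y} fx≡fy with <-cmp x y
  ... | tri< x<y _ _ = ⊥-elim (<⇒≢ (f-mono x<y) fx≡fy)
  ... | tri≈ _ x≡y _ = x≡y
  ... | tri> _ _ y<x = ⊥-elim (<⇒≢ (f-mono y<x) (sym fx≡fy))

  mutual
    map-DownUp : ∀ xs → DownUp xs → DownUp (map f xs)
    map-DownUp []          _            = tt
    map-DownUp (x ∷ [])    _            = tt
    map-DownUp (x ∷ y ∷ r) (y<x , rest) = f-mono y<x , map-UpDown (y ∷ r) rest

    map-UpDown : ∀ xs → UpDown xs → UpDown (map f xs)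
    map-UpDown []          _            = tt
    map-UpDown (x ∷ [])    _            = tt
    map-UpDown (x ∷ y ∷ r) (x<y , rest) = f-mono x<y , map-DownUp (y ∷ r) rest

⊆-map⁻ : ∀ (f : ℕ → ℕ) {vs} xs → vs ⊆ map f xs →
         Σ (List ℕ) λ us → us ⊆ xs × Pointwise (λ u v → f u ≡ v) us vs
⊆-map⁻ f []       []       = [] , [] , []
⊆-map⁻ f (x ∷ xs) (_ ∷ʳ h) with ⊆-map⁻ f xs h
... | us , us⊆xs , fus≡vs = us , x ∷ʳ us⊆xs , fus≡vs
⊆-map⁻ f (x ∷ xs) (refl ∷ h) with ⊆-map⁻ f xs h
... | us , us⊆xs , fus≡vs = x ∷ us , refl ∷ us⊆xs , refl ∷ fus≡vs

if-< : ∀ {A : Set} {x y} {t e : A} → x < y → (if x <ᵇ y then t else e) ≡ t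
if-< {x = x} {y} x<y with x <ᵇ y | <⇒<ᵇ x<y
... | true  | _  = refl
... | false | ()

if-≮ : ∀ {A : Set} {x y} {t e : A} → ¬ x < y → (if x <ᵇ y then t else e) ≡ e
if-≮ {x = x} {y} x≮y with x <ᵇ y | <ᵇ⇒< x y
... | false | _    = refl
... | true  | x<y  = ⊥-elim (x≮y (x<y tt))

-- The relabelling f = shift a b used by (a,b) → π, for a = c + 1 and b ≤ c:
-- values below b stay, values in [b, c) move up by one, values ≥ c by two.
module Shift (c b : ℕ) (b≤c : b ≤ c) where

  f : ℕ → ℕ
  f = shift (suc c) b

  f-low : ∀ {x} → x < b → f x ≡ x
  f-low x<b = if-< x<b

  f-mid : ∀ {x} → b ≤ x → x < c → f x ≡ suc x
  f-mid b≤x x<c = trans (if-≮ (≤⇒≯ b≤x)) (if-< x<c)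

  f-high : ∀ {x} → c ≤ x → f x ≡ suc (suc x)
  f-high c≤x = trans (if-≮ (≤⇒≯ (≤-trans b≤c c≤x))) (if-≮ (≤⇒≯ c≤x))

  data Region (x : ℕ) : Set where
    low  : x < b → Region x
    mid  : b ≤ x → x < c → Region x
    high : c ≤ x → Region x

  region : ∀ x → Region x
  region x with x <? b | x <? c
  ... | yes x<b | _       = low x<b
  ... | no  x≮b | yes x<c = mid (≮⇒≥ x≮b) x<c
  ... | no  _   | no  x≮c = high (≮⇒≥ x≮c)

  f-above : ∀ {x} → b ≤ x → suc x ≤ f x
  f-above {x} b≤x with region x
  ... | low x<b                         = ⊥-elim (<⇒≱ x<b b≤x)
  ... | mid _ x<c rewrite f-mid b≤x x<c = ≤-refl
  ... | high c≤x  rewrite f-high c≤x    = n≤1+n (suc x)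

  f-inflationary : ∀ x → x ≤ f x
  f-inflationary x with x <? b
  ... | yes x<b = ≤-reflexive (sym (f-low x<b))
  ... | no  x≮b = ≤-trans (n≤1+n x) (f-above (≮⇒≥ x≮b))

  f-at-most-2 : ∀ x → f x ≤ x + 2
  f-at-most-2 x rewrite +-comm x 2 with region x
  ... | low x<b rewrite f-low x<b = ≤-trans (n≤1+n x) (n≤1+n (suc x))
  ... | mid b≤x x<c rewrite f-mid b≤x x<c = n≤1+n (suc x)
  ... | high c≤x rewrite f-high c≤x = ≤-refl

  f-increasing : f Preserves _<_ ⟶ _<_
  f-increasing {x} {y} x<y with region x
  ... | low x<b rewrite f-low x<b = <-≤-trans x<y (f-inflationary y)
  ... | mid b≤x x<c rewrite f-mid b≤x x<c =
    <-≤-trans (s≤s x<y) (f-above (≤-trans b≤x (<⇒≤ x<y)))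
  ... | high c≤x rewrite f-high c≤x | f-high (≤-trans c≤x (<⇒≤ x<y)) = s≤s (s≤s x<y)

  open StrictlyIncreasing f f-increasing public

  b<f : ∀ {x} → b ≤ x → b < f x
  b<f b≤x = ≤-trans (s≤s b≤x) (f-above b≤x)

  below-b : ∀ {x} → f x < b → x < b
  below-b fx<b = ≰⇒> λ b≤x → <-asym (b<f b≤x) fx<b

  above-b : ∀ {x} → b < f x → b ≤ x
  above-b b<fx = ≮⇒≥ λ x<b → <-asym x<b (subst (b <_) (f-low x<b) b<fx)

  below-a : ∀ {x} → f x < suc c → x < c
  below-a {x} fx<a = ≰⇒> λ c≤x →
    <⇒≱ fx<a (≤-trans (s≤s (≤-trans c≤x (n≤1+n x))) (≤-reflexive (sym (f-high c≤x))))

  f≢b : ∀ x → f x ≢ b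
  f≢b x fx≡b with x <? b
  ... | yes x<b = <⇒≢ x<b (trans (sym (f-low x<b)) fx≡b)
  ... | no  x≮b = <⇒≢ (b<f (≮⇒≥ x≮b)) (sym fx≡b)

  f≢a : ∀ x → f x ≢ suc c
  f≢a x fx≡a with region x
  ... | low x<b      = <⇒≢ (<-≤-trans x<b (≤-trans b≤c (n≤1+n c))) (trans (sym (f-low x<b)) fx≡a)
  ... | mid b≤x x<c  = <⇒≢ (s≤s x<c) (trans (sym (f-mid b≤x x<c)) fx≡a)
  ... | high c≤x     = <⇒≢ (s≤s (s≤s c≤x)) (sym (trans (sym (f-high c≤x)) fx≡a))

  f-onto : ∀ v → v ≢ b → v ≢ suc c → Σ ℕ λ u → f u ≡ v × Region u
  f-onto v v≢b v≢a with <-cmp v b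
  ... | tri< v<b _ _ = v , f-low v<b , low v<b
  ... | tri≈ _ v≡b _ = ⊥-elim (v≢b v≡b)
  f-onto (suc w) _ v≢a | tri> _ _ (s≤s b≤w) with <-cmp w c
  ... | tri< w<c _ _ = w , f-mid b≤w w<c , mid b≤w w<c
  ... | tri≈ _ w≡c _ = ⊥-elim (v≢a (cong suc w≡c))
  f-onto (suc (suc u)) _ _ | tri> _ _ _ | tri> _ _ (s≤s c≤u) = u , f-high c≤u , high c≤u

range-unique : ∀ m → Unique (map suc (upTo m))
range-unique m = Unique.map⁺ suc-injective (Unique.upTo⁺ m)

∈-range⁺ : ∀ {v m} → 1 ≤ v → v ≤ m → v ∈ map suc (upTo m)
∈-range⁺ {suc w} _ w<m = ∈-map⁺ suc (∈-upTo⁺ w<m)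

∈-range⁻ : ∀ {v m} → v ∈ map suc (upTo m) → 1 ≤ v × v ≤ m
∈-range⁻ v∈ with ∈-map⁻ suc v∈
... | w , w∈ , refl = s≤s z≤n , ∈-upTo⁻ w∈

perm-unique : ∀ {m xs} → IsPerm m xs → Unique xs
perm-unique {m} σ = Unique-resp-↭ (setoid ℕ) (↭⇒↭ₛ (↭-sym σ)) (range-unique m)

perm-∈⁺ : ∀ {m xs v} → IsPerm m xs → 1 ≤ v → v ≤ m → v ∈ xs
perm-∈⁺ σ 1≤v v≤m = ∈-resp-↭ (↭-sym σ) (∈-range⁺ 1≤v v≤m)

perm-∈⁻ : ∀ {m xs v} → IsPerm m xs → v ∈ xs → 1 ≤ v × v ≤ m
perm-∈⁻ σ v∈ = ∈-range⁻ (∈-resp-↭ σ v∈)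

unique-range⇒perm : ∀ {m xs} → Unique xs →
  (∀ {v} → v ∈ xs → 1 ≤ v × v ≤ m) → (∀ {v} → 1 ≤ v → v ≤ m → v ∈ xs) → IsPerm m xs
unique-range⇒perm {m} u sound complete =
  ∼bag⇒↭ (unique∧set⇒bag u (range-unique m)
    (mk⇔ (λ v∈ → ∈-range⁺ (proj₁ (sound v∈)) (proj₂ (sound v∈)))
         (λ v∈ → complete (proj₁ (∈-range⁻ v∈)) (proj₂ (∈-range⁻ v∈)))))

module Gaps
  (n π₁ : ℕ) (rest : List ℕ) (perm : IsPerm n (π₁ ∷ rest))
  (p : ℕ) (as : ℕ → ℕ) (as-inc : ∀ i → i < p → as i < as (suc i))
  (𝒜 : ∀ k → InA (π₁ ∷ rest) k ⇔ (∃[ i ] (i ≤ p × as i ≡ k)))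
  (asp : as (suc p) ≡ π₁) where

  π : List ℕ
  π = π₁ ∷ rest

  π-unique : Unique π
  π-unique = perm-unique perm

  π₁≤n : π₁ ≤ n
  π₁≤n = proj₂ (perm-∈⁻ perm (here refl))

  as-mono : ∀ {i k} → i ≤ k → k ≤ p → as i ≤ as k
  as-mono {i} {zero}  z≤n _ = ≤-refl
  as-mono {i} {suc k} i≤k k<p with m≤n⇒m<n∨m≡n i≤k
  ... | inj₂ refl    = ≤-refl
  ... | inj₁ (s≤s i≤k′) = ≤-trans (as-mono i≤k′ (<⇒≤ k<p)) (<⇒≤ (as-inc k k<p))

  as-strict : ∀ {i k} → i < k → k ≤ p → as i < as k
  as-strict {i} {suc k} (s≤s i≤k) k<p = ≤-<-trans (as-mono i≤k (<⇒≤ k<p)) (as-inc k k<p)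

  as≤π₁ : ∀ {i} → i ≤ suc p → as i ≤ π₁
  as≤π₁ {i} i≤p+1 with m≤n⇒m<n∨m≡n i≤p+1
  ... | inj₂ refl = ≤-reflexive asp
  ... | inj₁ (s≤s i≤p) with inA⇒ascent π _ (Equivalence.from (𝒜 (as i)) (i , i≤p , refl))
  ...   | inj₂ (_ , bound) = ≤-trans (m≤m+n _ 2) bound
  ...   | inj₁ asᵢ≡0       = subst (_≤ π₁) (sym asᵢ≡0) z≤n

  index-below : ∀ {i j k} → as i ≡ k → i ≤ p → k < as (suc j) → i ≤ j
  index-below {i} {j} asᵢ≡k i≤p k<asⱼ₊₁ =
    ≮⇒≥ λ j<i → <⇒≱ k<asⱼ₊₁ (subst (as (suc j) ≤_) asᵢ≡k (as-mono j<i i≤p))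

  -- Inside a gap as j < k < k + 1 ≤ as (j + 1), the value k + 1 precedes k:
  -- otherwise k would belong to 𝒜(π) (or k + 1 = π₁ would occur twice).
  descent-step : ∀ {j k} → j ≤ p → as j < k → suc k ≤ as (suc j) → suc k ∷ k ∷ [] ⊆ π
  descent-step {j} {k} j≤p asⱼ<k k<asⱼ₊₁
    with before-total (perm-∈⁺ perm (≤-trans (s≤s z≤n) asⱼ<k) (<⇒≤ k+1≤n))
                      (perm-∈⁺ perm (s≤s z≤n) k+1≤n) (<⇒≢ (n<1+n k))
    where
      k+1≤n : suc k ≤ n
      k+1≤n = ≤-trans k<asⱼ₊₁ (≤-trans (as≤π₁ (s≤s j≤p)) π₁≤n)
  ... | inj₂ descent = descent
  ... | inj₁ ascent with suc (suc k) ≤? π₁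
  ...   | no  k+2≰π₁ = ⊥-elim (head∉tail π-unique (subst (_∈ rest) k+1≡π₁ (second∈tail ascent)))
    where
      k+1≡π₁ : suc k ≡ π₁
      k+1≡π₁ = ≤-antisym (≤-trans k<asⱼ₊₁ (as≤π₁ (s≤s j≤p))) (≤-pred (≰⇒> k+2≰π₁))
  ...   | yes k+2≤π₁
    with Equivalence.to (𝒜 k) (ascent⇒inA π k ascent (subst (_≤ π₁) (+-comm 2 k) k+2≤π₁))
  ...     | i , i≤p , asᵢ≡k =
    ⊥-elim (<⇒≱ asⱼ<k (subst (_≤ as j) asᵢ≡k (as-mono (index-below asᵢ≡k i≤p k<asⱼ₊₁) j≤p)))

  descending : ∀ {j c d} → j ≤ p → as j < c → c < d → d ≤ as (suc j) → d ∷ c ∷ [] ⊆ π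
  descending {j} {c} {suc d} j≤p asⱼ<c (s≤s c≤d) d<asⱼ₊₁ with m≤n⇒m<n∨m≡n c≤d
  ... | inj₂ refl = descent-step j≤p asⱼ<c d<asⱼ₊₁
  ... | inj₁ c<d  =
    before-trans π-unique (descent-step j≤p (<-≤-trans asⱼ<c (<⇒≤ c<d)) d<asⱼ₊₁)
                          (descending j≤p asⱼ<c c<d (≤-trans (n≤1+n d) d<asⱼ₊₁))

module Insertion
  (n π₁ : ℕ) (rest : List ℕ) (perm : IsPerm n (π₁ ∷ rest))
  (du : DownUp (π₁ ∷ rest)) (av : ¬ Contains4123 (π₁ ∷ rest))
  (p : ℕ) (as : ℕ → ℕ) (as0 : as 0 ≡ 0) (as-inc : ∀ i → i < p → as i < as (suc i))
  (𝒜 : ∀ k → InA (π₁ ∷ rest) k ⇔ (∃[ i ] (i ≤ p × as i ≡ k)))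
  (asp : as (suc p) ≡ π₁)
  (j c b : ℕ) (j≤p : j ≤ p) (a≤asⱼ₊₁+2 : suc c ≤ as (suc j) + 2)
  (b≤c : b ≤ c) (asⱼ+1≤b : as j + 1 ≤ b) (b≤π₁ : b ≤ π₁) where

  open Gaps n π₁ rest perm p as as-inc 𝒜 asp
  open Shift c b b≤c

  π′ : List ℕ
  π′ = suc c ∷ b ∷ map f π

  asⱼ<b : as j < b
  asⱼ<b = subst (_≤ b) (+-comm (as j) 1) asⱼ+1≤b

  c≤asⱼ₊₁+1 : c ≤ suc (as (suc j))
  c≤asⱼ₊₁+1 = ≤-pred (subst (suc c ≤_) (+-comm (as (suc j)) 2) a≤asⱼ₊₁+2)

  below-c : ∀ {v} → v < c → v ≤ as (suc j)
  below-c v<c = ≤-pred (<-≤-trans v<c c≤asⱼ₊₁+1)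

  below-c≤π₁ : ∀ {v} → v < c → v ≤ π₁
  below-c≤π₁ v<c = ≤-trans (below-c v<c) (as≤π₁ (s≤s j≤p))

  -- The values in [b, c) lie in the gap (as j, as (j + 1)], so no two of
  -- them form an ascent in π.
  no-ascent-from-b : ∀ {u v} → u ∷ v ∷ [] ⊆ π → b ≤ u → u < v → v < c → ⊥
  no-ascent-from-b u-before-v b≤u u<v v<c =
    before-asym π-unique u-before-v (descending j≤p (<-≤-trans asⱼ<b b≤u) u<v (below-c v<c))

  π′-unique : Unique π′
  π′-unique = All.tabulate a∉ ∷ All.tabulate b∉ ∷ Unique.map⁺ injective π-unique
    where
      a∉ : ∀ {x} → x ∈ b ∷ map f π → suc c ≢ x
      a∉ (here refl) = <⇒≢ (s≤s b≤c) ∘ sym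
      a∉ (there x∈) with ∈-map⁻ f x∈
      ... | u , _ , refl = f≢a u ∘ sym
      b∉ : ∀ {x} → x ∈ map f π → b ≢ x
      b∉ x∈ with ∈-map⁻ f x∈
      ... | u , _ , refl = f≢b u ∘ sym

  1≤b : 1 ≤ b
  1≤b = ≤-trans (s≤s z≤n) asⱼ<b

  π′-∈⁻ : ∀ {v} → v ∈ π′ → 1 ≤ v × v ≤ n + 2
  π′-∈⁻ (here refl) =
    s≤s z≤n , ≤-trans a≤asⱼ₊₁+2 (+-monoˡ-≤ 2 (≤-trans (as≤π₁ (s≤s j≤p)) π₁≤n))
  π′-∈⁻ (there (here refl)) = 1≤b , ≤-trans (≤-trans b≤π₁ π₁≤n) (m≤m+n n 2)
  π′-∈⁻ (there (there v∈)) with ∈-map⁻ f v∈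
  ... | u , u∈ , refl with perm-∈⁻ perm u∈
  ...   | 1≤u , u≤n = ≤-trans 1≤u (f-inflationary u) , ≤-trans (f-at-most-2 u) (+-monoˡ-≤ 2 u≤n)

  π′-∈⁺ : ∀ {v} → 1 ≤ v → v ≤ n + 2 → v ∈ π′
  π′-∈⁺ {v} 1≤v v≤n+2 with v ≟ suc c | v ≟ b
  ... | yes refl | _        = here refl
  ... | no  _    | yes refl = there (here refl)
  ... | no  v≢a  | no  v≢b with f-onto v v≢b v≢a
  ...   | u , refl , reg = there (there (∈-map⁺ f (perm-∈⁺ perm (proj₁ (bounds reg)) (proj₂ (bounds reg)))))
    where
      bounds : Region u → 1 ≤ u × u ≤ n
      bounds (low u<b)    = subst (1 ≤_) (f-low u<b) 1≤v , ≤-trans (<⇒≤ u<b) (≤-trans b≤π₁ π₁≤n)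
      bounds (mid b≤u u<c) = ≤-trans 1≤b b≤u , ≤-trans (below-c≤π₁ u<c) π₁≤n
      bounds (high c≤u)    = ≤-trans 1≤b (≤-trans b≤c c≤u) ,
        +-cancelʳ-≤ 2 u n (subst (_≤ n + 2) (trans (f-high c≤u) (+-comm 2 u)) v≤n+2)

  π′-perm : IsPerm (n + 2) π′
  π′-perm = unique-range⇒perm π′-unique π′-∈⁻ π′-∈⁺

  π′-downUp : DownUp π′
  π′-downUp = s≤s b≤c , b<f b≤π₁ , map-DownUp π du

  -- A 4123 in π′ either lies in the relabelled copy of π, or starts with a
  -- (then it is an ascent in [b,c) or an increasing triple below π₁ after
  -- π₁), or starts with b (an increasing triple below b ≤ π₁).
  π′-avoids : ¬ Contains4123 π′
  π′-avoids = no-occurrence ∘ contains⇒occurs π′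
    where
      no-occurrence : ¬ Occurs4123 π′
      no-occurrence (_ , _ , _ , _ , b<y , y<z , z<a , refl ∷ refl ∷ h)
        with ⊆-map⁻ f π h
      ... | _ ∷ _ ∷ [] , h′ , refl ∷ refl ∷ [] =
        no-ascent-from-b h′ (above-b b<y) (reflects-< y<z) (below-a z<a)
      no-occurrence (_ , _ , _ , _ , x<y , y<z , z<a , refl ∷ _ ∷ʳ h)
        with ⊆-map⁻ f π h
      ... | _ ∷ _ ∷ _ ∷ [] , h′ , refl ∷ refl ∷ refl ∷ [] =
        no-increasing-triple π-unique av h′ (reflects-< x<y) (reflects-< y<z)
          (below-c≤π₁ (below-a z<a))
      no-occurrence (_ , _ , _ , _ , x<y , y<z , z<b , _ ∷ʳ refl ∷ h)
        with ⊆-map⁻ f π h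
      ... | _ ∷ _ ∷ _ ∷ [] , h′ , refl ∷ refl ∷ refl ∷ [] =
        no-increasing-triple π-unique av h′ (reflects-< x<y) (reflects-< y<z)
          (<⇒≤ (<-≤-trans (below-b z<b) b≤π₁))
      no-occurrence (_ , _ , _ , _ , x<y , y<z , z<w , _ ∷ʳ _ ∷ʳ h)
        with ⊆-map⁻ f π h
      ... | _ ∷ _ ∷ _ ∷ _ ∷ [] , h′ , refl ∷ refl ∷ refl ∷ refl ∷ [] =
        av (occurs⇒contains π (reflects-< x<y) (reflects-< y<z) (reflects-< z<w) h′)

  Kept : ℕ → Set
  Kept k = k ≡ 0 ⊎ (suc k < b × ∃[ i ] (i ≤ j × as i ≡ k))

  -- An ascent k, k + 1 of the relabelled copy of π with k + 1 < a is the
  -- image of an ascent k, k + 1 of π lying below b (ascents in [b, c) do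
  -- not exist, and f fixes the values below b).
  shifted-ascent : ∀ {k} → k ∷ suc k ∷ [] ⊆ map f π → suc k < suc c →
                   suc k < b × k ∷ suc k ∷ [] ⊆ π
  shifted-ascent {k} h k+1<a with ⊆-map⁻ f π h
  ... | u ∷ v ∷ [] , h′ , fu≡k ∷ fv≡k+1 ∷ [] =
    subst (_< b) v≡k+1 v<b , subst₂ (λ x y → x ∷ y ∷ [] ⊆ π) u≡k v≡k+1 h′
    where
      u<v : u < v
      u<v = reflects-< (subst₂ _<_ (sym fu≡k) (sym fv≡k+1) (n<1+n k))
      u<b : u < b
      u<b = ≰⇒> λ b≤u →
        no-ascent-from-b h′ b≤u u<v (below-a (subst (_< suc c) (sym fv≡k+1) k+1<a))
      u≡k : u ≡ k
      u≡k = trans (sym (f-low u<b)) fu≡k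
      v<b : v < b
      v<b = ≰⇒> λ b≤v →
        <⇒≱ (b<f b≤v) (subst (_≤ b) (sym fv≡k+1) (subst (λ t → suc t ≤ b) u≡k u<b))
      v≡k+1 : v ≡ suc k
      v≡k+1 = trans (sym (f-low v<b)) fv≡k+1

  low-ascent⇒index : ∀ {k} → suc k < b → k ∷ suc k ∷ [] ⊆ π → ∃[ i ] (i ≤ j × as i ≡ k)
  low-ascent⇒index {k} k+1<b ascent with Equivalence.to (𝒜 k) (ascent⇒inA π k ascent k+2≤π₁)
    where
      k+2≤π₁ : k + 2 ≤ π₁
      k+2≤π₁ = subst (_≤ π₁) (+-comm 2 k) (≤-trans k+1<b b≤π₁)
  ... | i , i≤p , asᵢ≡k =
    i , index-below asᵢ≡k i≤p (below-c (<-≤-trans k+1<b b≤c)) , asᵢ≡k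

  ascent′⇒ : ∀ {k} → k ∷ suc k ∷ [] ⊆ π′ → suc k < suc c →
             Kept k ⊎ (k ≡ b × b + 1 < suc c)
  ascent′⇒ (refl ∷ _)       k+1<a = ⊥-elim (<⇒≱ k+1<a (n≤1+n _))
  ascent′⇒ (_ ∷ʳ refl ∷ _)  k+1<a = inj₂ (refl , subst (_< suc c) (+-comm 1 _) k+1<a)
  ascent′⇒ (_ ∷ʳ _ ∷ʳ h)    k+1<a with shifted-ascent h k+1<a
  ... | k+1<b , ascent = inj₁ (inj₂ (k+1<b , low-ascent⇒index k+1<b ascent))

  A′-characterisation : ∀ k → InA π′ k ⇔ (Kept k ⊎ (k ≡ b × b + 1 < suc c))
  A′-characterisation k = mk⇔ to from
    where
      to : InA π′ k → Kept k ⊎ (k ≡ b × b + 1 < suc c)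
      to A′k with inA⇒ascent π′ k A′k
      ... | inj₁ k≡0 = inj₁ (inj₁ k≡0)
      ... | inj₂ (ascent , k+2≤a) = ascent′⇒ ascent (subst (_≤ suc c) (+-comm k 2) k+2≤a)

      from : Kept k ⊎ (k ≡ b × b + 1 < suc c) → InA π′ k
      from (inj₁ (inj₁ k≡0)) = inj₁ k≡0
      from (inj₁ (inj₂ (k+1<b , i , i≤j , asᵢ≡k)))
        with inA⇒ascent π k (Equivalence.from (𝒜 k) (i , ≤-trans i≤j j≤p , asᵢ≡k))
      ... | inj₁ k≡0 = inj₁ k≡0
      ... | inj₂ (ascent , _) = ascent⇒inA π′ k (_ ∷ʳ _ ∷ʳ image) k+2≤a
        where
          image : k ∷ suc k ∷ [] ⊆ map f π
          image = subst₂ (λ x y → x ∷ y ∷ [] ⊆ map f π)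
            (f-low (<-trans (n<1+n k) k+1<b)) (f-low k+1<b) (map⁺ f ascent)
          k+2≤a : k + 2 ≤ suc c
          k+2≤a = subst (_≤ suc c) (+-comm 2 k) (≤-trans k+1<b (≤-trans b≤c (n≤1+n c)))
      from (inj₂ (refl , b+1<a)) = ascent⇒inA π′ b (_ ∷ʳ refl ∷ from∈ b+1∈) b+2≤a
        where
          b<c : b < c
          b<c = ≤-pred (subst (_< suc c) (+-comm b 1) b+1<a)
          b+1∈ : suc b ∈ map f π
          b+1∈ = subst (_∈ map f π) (f-mid ≤-refl b<c)
                   (∈-map⁺ f (perm-∈⁺ perm 1≤b (≤-trans b≤π₁ π₁≤n)))
          b+2≤a : b + 2 ≤ suc c
          b+2≤a = subst (_≤ suc c) (+-comm 2 b) (s≤s b<c)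

  kept-i : b ≡ as j + 1 → 1 ≤ j → ∀ k → Kept k ⇔ (∃[ i ] (i < j × as i ≡ k))
  kept-i b≡asⱼ+1 1≤j k = mk⇔ to from
    where
      b≡1+asⱼ : b ≡ suc (as j)
      b≡1+asⱼ = trans b≡asⱼ+1 (+-comm (as j) 1)

      to : Kept k → ∃[ i ] (i < j × as i ≡ k)
      to (inj₁ k≡0) = 0 , 1≤j , trans as0 (sym k≡0)
      to (inj₂ (k+1<b , i , i≤j , asᵢ≡k)) = i , ≤∧≢⇒< i≤j i≢j , asᵢ≡k
        where
          i≢j : i ≢ j
          i≢j refl = <-irrefl (sym (trans b≡1+asⱼ (cong suc asᵢ≡k))) k+1<b

      from : ∃[ i ] (i < j × as i ≡ k) → Kept k
      from (i , i<j , asᵢ≡k) = inj₂ (k+1<b , i , <⇒≤ i<j , asᵢ≡k)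
        where
          k+1<b : suc k < b
          k+1<b = subst (suc (suc k) ≤_) (sym b≡1+asⱼ)
                    (s≤s (subst (_< as j) asᵢ≡k (as-strict i<j j≤p)))

  -- Case (ii): otherwise Kept = {as i | i ≤ j}; as j + 1 < b fails only when
  -- b = as j + 1 and j = 0, where as j = 0 is kept anyway.
  kept-ii : ¬ (b ≡ as j + 1 × 1 ≤ j) → ∀ k → Kept k ⇔ (∃[ i ] (i ≤ j × as i ≡ k))
  kept-ii not-i k = mk⇔ to from
    where
      to : Kept k → ∃[ i ] (i ≤ j × as i ≡ k)
      to (inj₁ k≡0)            = 0 , z≤n , trans as0 (sym k≡0)
      to (inj₂ (_ , inherited)) = inherited

      from : ∃[ i ] (i ≤ j × as i ≡ k) → Kept k
      from (i , i≤j , asᵢ≡k) with suc (suc k) ≤? b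
      ... | yes k+1<b = inj₂ (k+1<b , i , i≤j , asᵢ≡k)
      ... | no  k+1≮b = inj₁ k≡0
        where
          k≤asⱼ : k ≤ as j
          k≤asⱼ = subst (_≤ as j) asᵢ≡k (as-mono i≤j j≤p)
          b≡asⱼ+1 : b ≡ as j + 1
          b≡asⱼ+1 = trans (≤-antisym (≤-trans (≤-pred (≰⇒> k+1≮b)) (s≤s k≤asⱼ)) asⱼ<b)
                          (+-comm 1 (as j))
          j≡0 : j ≡ 0
          j≡0 = n<1⇒n≡0 (≰⇒> λ 1≤j → not-i (b≡asⱼ+1 , 1≤j))
          k≡0 : k ≡ 0
          k≡0 = trans (sym asᵢ≡k) (trans (cong as (n≤0⇒n≡0 (subst (i ≤_) j≡0 i≤j))) as0)

split-b : ∀ {P Q : ℕ → Set} {a b : ℕ} →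
  (∀ k → P k ⇔ (Q k ⊎ (k ≡ b × b + 1 < a))) →
  (b + 1 < a → ∀ k → P k ⇔ (Q k ⊎ k ≡ b)) × (a ≡ b + 1 → ∀ k → P k ⇔ Q k)
split-b {P} {Q} {a} {b} P⇔ =
  (λ b+1<a k → mk⇔ (map₂ proj₁ ∘ to k) (from k ∘ map₂ (_, b+1<a))) ,
  (λ a≡b+1 k → mk⇔ (only-Q a≡b+1 k) (from k ∘ inj₁))
  where
    to : ∀ k → P k → Q k ⊎ (k ≡ b × b + 1 < a)
    to k = Equivalence.to (P⇔ k)
    from : ∀ k → Q k ⊎ (k ≡ b × b + 1 < a) → P k
    from k = Equivalence.from (P⇔ k)
    only-Q : a ≡ b + 1 → ∀ k → P k → Q k
    only-Q a≡b+1 k Pk with to k Pk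
    ... | inj₁ q            = q
    ... | inj₂ (_ , b+1<a)  = ⊥-elim (<-irrefl (sym a≡b+1) b+1<a)

lemma2p4 : (n : ℕ) → 1 ≤ n → (π : List ℕ) → InDU4123 n π →
    (p : ℕ) (as : ℕ → ℕ) → as 0 ≡ 0 → (∀ i → i < p → as i < as (suc i)) →
    (∀ k → InA π k ⇔ (∃[ i ] (i ≤ p × as i ≡ k))) →
    as (suc p) ≡ first π →
    (j a b : ℕ) → j ≤ p → a ≤ as (suc j) + 2 → b < a → as j + 1 ≤ b → b ≤ first π →
    InDU4123 (n + 2) (insertAB a b π) ×
    ((b ≡ as j + 1 → 1 ≤ j →
        (b + 1 < a → ∀ k → InA (insertAB a b π) k ⇔ ((∃[ i ] (i < j × as i ≡ k)) ⊎ k ≡ b)) ×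
        (a ≡ b + 1 → ∀ k → InA (insertAB a b π) k ⇔ (∃[ i ] (i < j × as i ≡ k)))) ×
     (¬ (b ≡ as j + 1 × 1 ≤ j) →
        (b + 1 < a → ∀ k → InA (insertAB a b π) k ⇔ ((∃[ i ] (i ≤ j × as i ≡ k)) ⊎ k ≡ b)) ×
        (a ≡ b + 1 → ∀ k → InA (insertAB a b π) k ⇔ (∃[ i ] (i ≤ j × as i ≡ k)))))
lemma2p4 n 1≤n [] (perm , _) _ _ _ _ _ _ _ _ _ _ _ _ _ _ with perm-∈⁺ perm ≤-refl 1≤n
... | ()
lemma2p4 _ _ (_ ∷ _) _ _ _ _ _ _ _ _ zero _ _ _ () _ _
lemma2p4 n _ (π₁ ∷ rest) (perm , du , av) p as as0 as-inc 𝒜 asp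
         j (suc c) b j≤p a≤asⱼ₊₁+2 (s≤s b≤c) asⱼ+1≤b b≤π₁ =
  (π′-perm , π′-downUp , π′-avoids) ,
  (λ b≡asⱼ+1 1≤j → split-b λ k → (kept-i b≡asⱼ+1 1≤j k ⊎-⇔ ⇔-id _) ⇔-∘ A′-characterisation k) ,
  (λ not-i → split-b λ k → (kept-ii not-i k ⊎-⇔ ⇔-id _) ⇔-∘ A′-characterisation k)
  where
    open Insertion n π₁ rest perm du av p as as0 as-inc 𝒜 asp
                   j c b j≤p a≤asⱼ₊₁+2 b≤c asⱼ+1≤b b≤π₁
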